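{- Let $G=(V,E)$ satisfy the standing assumptions and have highway dimension at most $h$. Then there is a constant $c$ depending only on $h$ such that for every $r>0$ and every $v\in V$, there are at most $c$ edges of weight at least $r$ having at least one endpoint in $B(v,2r)$.
   Context: Standing assumptions: $G$ is a finite connected undirected graph, edge weights at least $1$, shortest paths unique ($p(u,w)$, length $d(u,w)$), and every edge is the shortest path between its endpoints. $B(v,r)=\{v': d(v,v')\le r\}$. Highway dimension: for a shortest path $p$ from $u$ to $w$ and $r>0$, an $r$-witness of $p$ is a shortest path $p'$ of length at least $r$ containing $p$ as a subpath, with endpoints $u$ or a neighbor of $u$, and $w$ or a neighbor of $w$; $p$ is $r$-significant if it has an $r$-witness. $d(v,q)$ is the minimum distance from $v$ to a vertex of path $q$. $S(v,r)$ is the set of $r$-significant shortest paths having an $r$-witness $p'$ with $d(v,p')\le 2r$. The highway dimension of $G$ is the smallest $h$ such that for all $r>0$, $v\in V$ there is $C\subseteq V$, $|C|\le h$, meeting every $p\in S(v,r)$.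
   Formalization: The edge weights are rational, and both the radius r in the claim and the scale r in the definition of highway dimension range over the positive rationals. -}

module Defs where

open import Data.Nat using (ℕ)
open import Data.Fin using (Fin)
open import Data.Maybe using (Maybe; just; nothing)
open import Data.List using (List; []; _∷_; _++_; length)
open import Data.List.Membership.Propositional using (_∈_)
open import Data.Product using (Σ; ∃; ∃-syntax; _×_; _,_)
open import Data.Sum using (_⊎_)
open import Data.Rational using (ℚ; 0ℚ; 1ℚ; _≤_; _<_; _+_)
open import Relation.Binary.PropositionalEquality using (_≡_)

-- A finite weighted undirected simple graph on vertex set Fin n.
-- weight x y ≡ just q  means {x,y} is an edge of weight q;  nothing means no edge.
record Graph : Set where
  field
    n      : ℕ
    weight : Fin n → Fin n → Maybe ℚ

module _ (G : Graph) where
  open Graph G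

  V : Set
  V = Fin n

  Adj : V → V → Set
  Adj x y = ∃[ q ] (weight x y ≡ just q)

  -- weight of a pair (0 if not an edge; only used on walks, where it is an edge)
  wt : V → V → ℚ
  wt x y with weight x y
  ... | just q  = q
  ... | nothing = 0ℚ

  data IsWalk : V → V → List V → Set where
    single : ∀ {u} → IsWalk u u (u ∷ [])
    step   : ∀ {u x w xs} → Adj u x → IsWalk x w (x ∷ xs) → IsWalk u w (u ∷ x ∷ xs)

  len : List V → ℚ
  len []             = 0ℚ
  len (x ∷ [])       = 0ℚ
  len (x ∷ y ∷ rest) = wt x y + len (y ∷ rest)

  Shortest : V → V → List V → Set
  Shortest u w p = IsWalk u w p × (∀ q → IsWalk u w q → len p ≤ len q)

  Dist≤ : V → V → ℚ → Set
  Dist≤ u w r = ∃[ p ] (IsWalk u w p × len p ≤ r)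

  InBall : V → ℚ → V → Set
  InBall v r v' = Dist≤ v v' r

  SubPath : List V → List V → Set
  SubPath p p' = ∃[ xs ] ∃[ ys ] (p' ≡ xs ++ p ++ ys)

  PathDist≤ : V → List V → ℚ → Set
  PathDist≤ v q r = ∃[ x ] (x ∈ q × Dist≤ v x r)

  Witness : ℚ → V → V → List V → List V → Set
  Witness r u w p p' =
    ∃[ a ] ∃[ b ] (Shortest a b p' × r ≤ len p' × SubPath p p'
                   × (a ≡ u ⊎ Adj a u) × (b ≡ w ⊎ Adj b w))

  InS : V → ℚ → List V → Set
  InS v r p = ∃[ u ] ∃[ w ] (Shortest u w p
              × ∃[ p' ] (Witness r u w p p' × PathDist≤ v p' (r + r)))

  HighwayDim≤ : ℕ → Set
  HighwayDim≤ h = ∀ (r : ℚ) → 0ℚ < r → ∀ (v : V) →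
    ∃[ C ] (length C Data.Nat.≤ h × (∀ p → InS v r p → ∃[ x ] (x ∈ C × x ∈ p)))

  record StandingAssumptions : Set where
    field
      symmetric    : ∀ x y → weight x y ≡ weight y x
      noLoops      : ∀ x → weight x x ≡ nothing
      weight≥1     : ∀ x y q → weight x y ≡ just q → 1ℚ ≤ q
      shortestExists : ∀ u w → ∃[ p ] Shortest u w p
      shortestUnique : ∀ u w p q → Shortest u w p → Shortest u w q → p ≡ q
      edgeShortest : ∀ x y → Adj x y → Shortest x y (x ∷ y ∷ [])

  HeavyEdgesNear≤ : ℕ → ℚ → V → Set
  HeavyEdgesNear≤ c r v = ∃[ L ] (length L Data.Nat.≤ c ×
    (∀ x y q → weight x y ≡ just q → r ≤ q →
       (InBall v (r + r) x ⊎ InBall v (r + r) y) →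
       ((x , y) ∈ L ⊎ (y , x) ∈ L)))

{-# OPTIONS --safe #-}
-- A single vertex y is an r-significant path: an edge x–y of weight at least r
-- is an r-witness of it, because a witness may extend a path by a neighbour at
-- either end.  If the edge meets B(v,2r), this witness lies within 2r of v, so
-- both trivial paths [x] and [y] belong to S(v,r).  A set C of at most h
-- vertices meeting S(v,r) therefore contains both endpoints of every such edge,
-- and these edges are among the h² pairs of vertices of C.
module Submission where

open import Defs
open import Data.Nat using (ℕ)
open import Data.Product using (∃-syntax)
open import Data.Rational using (ℚ; 0ℚ; _<_)

import Data.Nat as ℕ
import Data.Nat.Properties as ℕ
open import Data.List using (List; []; _∷_; [_]; _++_; length; map; cartesianProduct)
open import Data.List.Properties using (length-++; length-map)
open import Data.List.Membership.Propositional using (_∈_)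
open import Data.List.Membership.Propositional.Properties using (∈-cartesianProduct⁺)
open import Data.List.Relation.Unary.Any using (here; there)
open import Data.Maybe using (just)
open import Data.Product using (_×_; _,_)
open import Data.Sum using (_⊎_; inj₁; inj₂; swap)
open import Data.Rational using (1ℚ; _≤_; _+_)
import Data.Rational.Properties as ℚ
open import Relation.Binary.PropositionalEquality
  using (_≡_; refl; sym; trans; cong₂; subst; module ≡-Reasoning)

length-cartesianProduct : {A B : Set} (xs : List A) (ys : List B) →
                          length (cartesianProduct xs ys) ≡ length xs ℕ.* length ys
length-cartesianProduct []       ys = refl
length-cartesianProduct (x ∷ xs) ys = begin
  length (map (x ,_) ys ++ cartesianProduct xs ys)
    ≡⟨ length-++ (map (x ,_) ys) ⟩
  length (map (x ,_) ys) ℕ.+ length (cartesianProduct xs ys)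
    ≡⟨ cong₂ ℕ._+_ (length-map (x ,_) ys) (length-cartesianProduct xs ys) ⟩
  length ys ℕ.+ length xs ℕ.* length ys ∎
  where open ≡-Reasoning

∈-singleton-meeting : {A : Set} {C : List A} {y : A} → ∃[ z ] (z ∈ C × z ∈ [ y ]) → y ∈ C
∈-singleton-meeting (_ , z∈C , here refl) = z∈C

module _ (G : Graph) (SA : StandingAssumptions G) where
  open Graph G
  open StandingAssumptions SA

  wt-edge : ∀ {x y q} → weight x y ≡ just q → wt G x y ≡ q
  wt-edge {x} {y} e with weight x y
  wt-edge refl | just _ = refl

  0≤wt : ∀ {x y} → Adj G x y → 0ℚ ≤ wt G x y
  0≤wt {x} {y} (q , e) = subst (0ℚ ≤_) (sym (wt-edge e))
    (ℚ.≤-trans (ℚ.<⇒≤ (ℚ.positive⁻¹ 1ℚ)) (weight≥1 x y q e))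

  0≤len : ∀ {u w p} → IsWalk G u w p → 0ℚ ≤ len G p
  0≤len single        = ℚ.≤-refl
  0≤len (step adj pw) =
    ℚ.≤-trans (ℚ.≤-reflexive (sym (ℚ.+-identityˡ 0ℚ))) (ℚ.+-mono-≤ (0≤wt adj) (0≤len pw))

  trivialPath-shortest : ∀ y → Shortest G y y [ y ]
  trivialPath-shortest y = single , λ _ → 0≤len

  heavyEdge-witness : ∀ {x y q r} → weight x y ≡ just q → r ≤ q →
                      Witness G r y y [ y ] (x ∷ y ∷ [])
  heavyEdge-witness {x} {y} {q} e r≤q =
    x , y , edgeShortest x y (q , e) , r≤len , ([ x ] , [] , refl) , inj₂ (q , e) , inj₁ refl
    where
    r≤len : _ ≤ wt G x y + 0ℚ
    r≤len = subst (_ ≤_) (sym (trans (ℚ.+-identityʳ (wt G x y)) (wt-edge e))) r≤q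

  heavyEdge-endpoint∈S : ∀ {x y q} v r → weight x y ≡ just q → r ≤ q →
                         InBall G v (r + r) x ⊎ InBall G v (r + r) y → InS G v r [ y ]
  heavyEdge-endpoint∈S {x} {y} v r e r≤q near =
    y , y , trivialPath-shortest y , (x ∷ y ∷ []) , heavyEdge-witness e r≤q , edgeNear near
    where
    edgeNear : InBall G v (r + r) x ⊎ InBall G v (r + r) y → PathDist≤ G v (x ∷ y ∷ []) (r + r)
    edgeNear (inj₁ x-near) = x , here refl , x-near
    edgeNear (inj₂ y-near) = y , there (here refl) , y-near

mainTheorem4 : ∀ (h : ℕ) → ∃[ c ] (∀ (G : Graph) → StandingAssumptions G → HighwayDim≤ G h →
    ∀ (r : ℚ) → 0ℚ < r → ∀ (v : V G) → HeavyEdgesNear≤ G c r v)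
mainTheorem4 h = h ℕ.* h , λ G SA hd r r>0 v →
  let (C , |C|≤h , C-hits) = hd r r>0 v
      endpoint∈C : ∀ {x y q} → Graph.weight G x y ≡ just q → r ≤ q →
                   InBall G v (r + r) x ⊎ InBall G v (r + r) y → y ∈ C
      endpoint∈C e r≤q near =
        ∈-singleton-meeting (C-hits _ (heavyEdge-endpoint∈S G SA v r e r≤q near))
  in cartesianProduct C C
   , subst (ℕ._≤ h ℕ.* h) (sym (length-cartesianProduct C C)) (ℕ.*-mono-≤ |C|≤h |C|≤h)
   , λ x y q e r≤q near →
       let e′ = trans (StandingAssumptions.symmetric SA y x) e
       in inj₁ (∈-cartesianProduct⁺ (endpoint∈C e′ r≤q (swap near)) (endpoint∈C e r≤q near))
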